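{- Let $p_n$ denote the number of decorated Dyck paths of length $n$ (defined in the context) that have no peak at level $1$. Then, as formal power series in $z$, \[ \sum_{n\ge 0} p_n z^n \;=\; \frac{1-z^4-\sqrt{1-6z^2+5z^4}}{(z^2+3)\,z^2}, \] where the square root denotes the formal power series with constant term $1$. Equivalently, with $x=z^2$, $\sum_{m\ge0} p_{2m}x^m = \dfrac{1-x^2-\sqrt{1-6x+5x^2}}{x(x+3)}$, and $p_n=0$ for odd $n$.
   Context: A decorated Dyck path (equivalently, a skew Dyck path with each south-west step $(-1,-1)$ redrawn as a red south-east step) of length $n$ is a sequence of $n$ steps, each being an up-step $U=(1,1)$, a black down-step $D=(1,-1)$, or a red down-step $R=(1,-1)$, starting at $(0,0)$, never going below the $x$-axis, ending on the $x$-axis, and such that an up-step is never immediately followed by a red down-step and a red down-step is never immediately followed by an up-step. A peak at level $1$ is an up-step from height $0$ to height $1$ immediately followed by a down-step. The empty path is counted, so $p_0=1$. -}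

module Defs where

open import Data.Nat using (ℕ; zero; suc; _∸_)
open import Data.Bool using (Bool; true; false; _∧_; not; if_then_else_)
open import Data.List using (List; []; _∷_; map; concatMap; upTo)
open import Data.Nat.ListAction using (sum)
open import Data.Integer as ℤ using (ℤ; +_; -[1+_])

-- Steps of a decorated Dyck path: U = (1,1), D = black (1,-1), R = red (1,-1)

data Step : Set where
  U D R : Step

words : ℕ → List (List Step)
words zero    = [] ∷ []
words (suc n) = concatMap (λ w → (U ∷ w) ∷ (D ∷ w) ∷ (R ∷ w) ∷ []) (words n)

dyckFrom : ℕ → List Step → Bool
dyckFrom zero    []      = true
dyckFrom (suc h) []      = false
dyckFrom h       (U ∷ w) = dyckFrom (suc h) w
dyckFrom zero    (D ∷ w) = false
dyckFrom (suc h) (D ∷ w) = dyckFrom h w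
dyckFrom zero    (R ∷ w) = false
dyckFrom (suc h) (R ∷ w) = dyckFrom h w

noForbidden : List Step → Bool
noForbidden (U ∷ R ∷ w) = false
noForbidden (R ∷ U ∷ w) = false
noForbidden (s ∷ w)     = noForbidden w
noForbidden []          = true

isDecorated : List Step → Bool
isDecorated w = dyckFrom 0 w ∧ noForbidden w

peakLevel1From : ℕ → List Step → Bool
peakLevel1From zero (U ∷ D ∷ w) = true
peakLevel1From zero (U ∷ R ∷ w) = true
peakLevel1From h    (U ∷ w)     = peakLevel1From (suc h) w
peakLevel1From h    (D ∷ w)     = peakLevel1From (h ∸ 1) w
peakLevel1From h    (R ∷ w)     = peakLevel1From (h ∸ 1) w
peakLevel1From h    []          = false

good : List Step → Bool
good w = isDecorated w ∧ not (peakLevel1From 0 w)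

p : ℕ → ℕ
p n = sum (map (λ w → if good w then 1 else 0) (words n))

Series : Set
Series = ℕ → ℤ

_⋆_ : Series → Series → Series
(f ⋆ g) n = Data.List.foldr ℤ._+_ (+ 0) (map (λ k → f k ℤ.* g (n ∸ k)) (upTo (suc n)))

_⊝_ : Series → Series → Series
(f ⊝ g) n = f n ℤ.- g n

poly : List ℤ → Series
poly []       n       = + 0
poly (c ∷ cs) zero    = c
poly (c ∷ cs) (suc n) = poly cs n

P : Series
P n = + p n

-- Write x = z².  A nonempty decorated path is U a X b with a a decorated path lifted by
-- one and X a down-step; X = D allows any decorated b, while X = R forces a ≠ [] (no U R)
-- and b = [] (no R U).  So the series C of nonempty decorated paths satisfies
-- C = x (1 + 3C + C²), and since a path without a peak at level 1 is a sequence of such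
-- arches with a ≠ [], P = 1 + x (C P + C).  With S = 1 − 3x − 2xC, the quadratic for C
-- gives S² = 1 − 6x + 5x².  The defect Y = (3 + x) P − (3 − x + 2C) satisfies Y = x C Y,
-- hence Y = 0, and x Y = 0 is x (x + 3) P = 1 − x² − S.
--
-- Path counts are totals of ℤ-valued weights over all words of a given length.  A weight
-- summing over the factorisations of a word has the Cauchy product of the totals as its
-- total, and the arch decomposition holds word by word, through the first passage of a
-- path to level 0.

module Submission where

open import Defs
open import Data.Bool using (Bool; true; false; _∧_; not; if_then_else_)
open import Data.Bool.Properties using (∧-identityʳ; ∧-zeroʳ)
open import Data.Empty using (⊥-elim)
open import Data.Integer using (ℤ; +_; -[1+_]; _+_; _*_; _-_)
open import Data.Integer.Properties
  using (+-identityˡ; +-identityʳ; +-assoc; +-comm; *-comm; *-zeroʳ; *-identityˡ; *-distribʳ-+; pos-+)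
open import Data.Integer.Tactic.RingSolver using (solve-∀)
open import Data.List using (List; []; _∷_; foldr; map; concatMap; upTo)
open import Data.List.Properties using (map-applyUpTo; map-cong)
open import Data.Nat as ℕ using (ℕ; zero; suc; pred; _∸_; _≤_; _<_; z≤n; s≤s)
open import Data.Nat.Induction using (<-rec)
open import Data.Nat.ListAction using (sum)
import Data.Nat.Properties as ℕₚ
open import Data.Nat.Tactic.RingSolver using () renaming (solve-∀ to solveℕ)
open import Data.Product using (Σ; _×_; _,_)
open import Function using (_∘_)
open import Relation.Binary.PropositionalEquality

-- Formal power series

infixl 6 _⊕_
infixr 7 _·_ x·_

_⊕_ : Series → Series → Series
(f ⊕ g) n = f n + g n

_·_ : ℤ → Series → Series
(c · f) n = c * f n

shift : Series → Series
shift f zero    = + 0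
shift f (suc n) = f n

-- multiplication by x = z²
x·_ : Series → Series
x· f = shift (shift f)

shift-cong : ∀ {f g} → f ≗ g → shift f ≗ shift g
shift-cong f≗g zero    = refl
shift-cong f≗g (suc n) = f≗g n

x·-cong : ∀ {f g} → f ≗ g → x· f ≗ x· g
x·-cong f≗g = shift-cong (shift-cong f≗g)

one : Series
one = poly (+ 1 ∷ [])

⋆-zero : ∀ f g → (f ⋆ g) 0 ≡ f 0 * g 0
⋆-zero f g = +-identityʳ (f 0 * g 0)

⋆-suc : ∀ f g n → (f ⋆ g) (suc n) ≡ f 0 * g (suc n) + ((f ∘ suc) ⋆ g) n
⋆-suc f g n = cong (λ t → f 0 * g (suc n) + t) (cong (foldr _+_ (+ 0))
  (trans (map-applyUpTo suc (λ k → f k * g (suc n ∸ k)) (suc n))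
         (sym (map-applyUpTo (λ k → k) (λ k → f (suc k) * g (n ∸ k)) (suc n)))))

⋆-cong : ∀ {f f′ g g′} → f ≗ f′ → g ≗ g′ → f ⋆ g ≗ f′ ⋆ g′
⋆-cong f≗f′ g≗g′ n =
  cong (foldr _+_ (+ 0)) (map-cong (λ k → cong₂ _*_ (f≗f′ k) (g≗g′ (n ∸ k))) (upTo (suc n)))

⋆-congʳ : ∀ f {g g′} → g ≗ g′ → f ⋆ g ≗ f ⋆ g′
⋆-congʳ f = ⋆-cong {f} {f} (λ _ → refl)

⋆-congˡ : ∀ {f f′} g → f ≗ f′ → f ⋆ g ≗ f′ ⋆ g
⋆-congˡ g f≗f′ = ⋆-cong f≗f′ (λ _ → refl)

⋆-sucʳ : ∀ f g n → (f ⋆ g) (suc n) ≡ (f ⋆ (g ∘ suc)) n + f (suc n) * g 0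
⋆-sucʳ f g zero = begin
  (f ⋆ g) 1                          ≡⟨ ⋆-suc f g 0 ⟩
  f 0 * g 1 + ((f ∘ suc) ⋆ g) 0      ≡⟨ cong (λ t → f 0 * g 1 + t) (⋆-zero (f ∘ suc) g) ⟩
  f 0 * g 1 + f 1 * g 0              ≡⟨ cong (λ t → t + f 1 * g 0) (⋆-zero f (g ∘ suc)) ⟨
  (f ⋆ (g ∘ suc)) 0 + f 1 * g 0      ∎
  where open ≡-Reasoning
⋆-sucʳ f g (suc n) = begin
  (f ⋆ g) (suc (suc n))                                              ≡⟨ ⋆-suc f g (suc n) ⟩
  f 0 * g (suc (suc n)) + ((f ∘ suc) ⋆ g) (suc n)                    ≡⟨ cong (λ t → f 0 * g (suc (suc n)) + t) (⋆-sucʳ (f ∘ suc) g n) ⟩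
  f 0 * g (suc (suc n)) + (((f ∘ suc) ⋆ (g ∘ suc)) n + f (suc (suc n)) * g 0)
                                                                     ≡⟨ +-assoc (f 0 * g (suc (suc n))) _ _ ⟨
  f 0 * g (suc (suc n)) + ((f ∘ suc) ⋆ (g ∘ suc)) n + f (suc (suc n)) * g 0
                                                                     ≡⟨ cong (λ t → t + f (suc (suc n)) * g 0) (⋆-suc f (g ∘ suc) n) ⟨
  (f ⋆ (g ∘ suc)) (suc n) + f (suc (suc n)) * g 0                    ∎
  where open ≡-Reasoning

⋆-comm : ∀ f g → f ⋆ g ≗ g ⋆ f
⋆-comm f g zero = trans (⋆-zero f g) (trans (*-comm (f 0) (g 0)) (sym (⋆-zero g f)))
⋆-comm f g (suc n) = begin
  (f ⋆ g) (suc n)                        ≡⟨ ⋆-suc f g n ⟩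
  f 0 * g (suc n) + ((f ∘ suc) ⋆ g) n    ≡⟨ cong₂ _+_ (*-comm (f 0) (g (suc n))) (⋆-comm (f ∘ suc) g n) ⟩
  g (suc n) * f 0 + (g ⋆ (f ∘ suc)) n    ≡⟨ +-comm (g (suc n) * f 0) _ ⟩
  (g ⋆ (f ∘ suc)) n + g (suc n) * f 0    ≡⟨ ⋆-sucʳ g f n ⟨
  (g ⋆ f) (suc n)                        ∎
  where open ≡-Reasoning

⋆-distribʳ-⊕ : ∀ f g h → (f ⊕ g) ⋆ h ≗ (f ⋆ h) ⊕ (g ⋆ h)
⋆-distribʳ-⊕ f g h zero =
  trans (⋆-zero (f ⊕ g) h) (trans (*-distribʳ-+ (h 0) (f 0) (g 0))
    (sym (cong₂ _+_ (⋆-zero f h) (⋆-zero g h))))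
⋆-distribʳ-⊕ f g h (suc n) =
  trans (⋆-suc (f ⊕ g) h n)
    (trans (cong (λ t → (f 0 + g 0) * h (suc n) + t) (⋆-distribʳ-⊕ (f ∘ suc) (g ∘ suc) h n))
      (trans (shuffle (f 0) (g 0) (h (suc n)) _ _)
        (sym (cong₂ _+_ (⋆-suc f h n) (⋆-suc g h n)))))
  where
  shuffle : ∀ a b c x y → (a + b) * c + (x + y) ≡ (a * c + x) + (b * c + y)
  shuffle = solve-∀

·-⋆-assoc : ∀ c f g → (c · f) ⋆ g ≗ c · (f ⋆ g)
·-⋆-assoc c f g zero =
  trans (⋆-zero (c · f) g) (trans (assoc c (f 0) (g 0)) (cong (c *_) (sym (⋆-zero f g))))
  where
  assoc : ∀ a b d → a * b * d ≡ a * (b * d)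
  assoc = solve-∀
·-⋆-assoc c f g (suc n) =
  trans (⋆-suc (c · f) g n)
    (trans (cong (λ t → c * f 0 * g (suc n) + t) (·-⋆-assoc c (f ∘ suc) g n))
      (trans (factor c (f 0) (g (suc n)) _) (cong (c *_) (sym (⋆-suc f g n)))))
  where
  factor : ∀ a b d t → a * b * d + a * t ≡ a * (b * d + t)
  factor = solve-∀

shift-⋆ : ∀ f g → shift f ⋆ g ≗ shift (f ⋆ g)
shift-⋆ f g zero    = ⋆-zero (shift f) g
shift-⋆ f g (suc n) = trans (⋆-suc (shift f) g n) (+-identityˡ _)

x·-⋆ : ∀ f g → (x· f) ⋆ g ≗ x· (f ⋆ g)
x·-⋆ f g zero    = shift-⋆ (shift f) g 0
x·-⋆ f g (suc n) = trans (shift-⋆ (shift f) g (suc n)) (shift-⋆ f g n)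

·x·-⋆ : ∀ c g f → (c · x· g) ⋆ f ≗ c · x· (g ⋆ f)
·x·-⋆ c g f n = trans (·-⋆-assoc c (x· g) f n) (cong (c *_) (x·-⋆ g f n))

⋆-vanishesˡ : ∀ f g n → (∀ k → k ≤ n → f k ≡ + 0) → (f ⋆ g) n ≡ + 0
⋆-vanishesˡ f g zero    f≡0 = trans (⋆-zero f g) (cong (_* g 0) (f≡0 0 z≤n))
⋆-vanishesˡ f g (suc n) f≡0 =
  trans (⋆-suc f g n)
    (cong₂ _+_ (cong (_* g (suc n)) (f≡0 0 z≤n))
               (⋆-vanishesˡ (f ∘ suc) g n (λ k k≤n → f≡0 (suc k) (s≤s k≤n))))

⋆-identityˡ : ∀ g → one ⋆ g ≗ g
⋆-identityˡ g zero    = trans (⋆-zero one g) (*-identityˡ (g 0))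
⋆-identityˡ g (suc n) =
  trans (⋆-suc one g n)
    (trans (cong₂ _+_ (*-identityˡ (g (suc n))) (⋆-vanishesˡ (poly []) g n (λ _ _ → refl)))
      (+-identityʳ (g (suc n))))

⋆-identityʳ : ∀ f → f ⋆ one ≗ f
⋆-identityʳ f n = trans (⋆-comm f one n) (⋆-identityˡ f n)

x·⋆-fixedPoint-zero : ∀ f h → f ≗ x· (f ⋆ h) → ∀ n → f n ≡ + 0
x·⋆-fixedPoint-zero f h f≗x·f⋆h = <-rec (λ n → f n ≡ + 0) vanish
  where
  vanish : ∀ n → (∀ {m} → m < n → f m ≡ + 0) → f n ≡ + 0
  vanish zero          _  = f≗x·f⋆h 0
  vanish (suc zero)    _  = f≗x·f⋆h 1
  vanish (suc (suc n)) ih = trans (f≗x·f⋆h (suc (suc n)))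
    (⋆-vanishesˡ f h n (λ k k≤n → ih (s≤s (ℕₚ.m≤n⇒m≤1+n k≤n))))

-- Weights on words

Weight : Set
Weight = List Step → ℤ

𝟙 : Bool → ℤ
𝟙 b = + (if b then 1 else 0)

total : Weight → Series
total f zero    = f []
total f (suc n) = total (f ∘ (U ∷_)) n + total (f ∘ (D ∷_)) n + total (f ∘ (R ∷_)) n

total-cong : ∀ {f g} → (∀ w → f w ≡ g w) → total f ≗ total g
total-cong f≗g zero    = f≗g []
total-cong f≗g (suc n) =
  cong₂ _+_ (cong₂ _+_ (total-cong (f≗g ∘ (U ∷_)) n) (total-cong (f≗g ∘ (D ∷_)) n))
            (total-cong (f≗g ∘ (R ∷_)) n)

total-zero : ∀ n → total (λ _ → + 0) n ≡ + 0
total-zero zero    = refl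
total-zero (suc n) rewrite total-zero n = refl

total-+ : ∀ f g → total (λ w → f w + g w) ≗ total f ⊕ total g
total-+ f g zero    = refl
total-+ f g (suc n) =
  trans (cong₂ _+_ (cong₂ _+_ (total-+ (f ∘ (U ∷_)) (g ∘ (U ∷_)) n)
                              (total-+ (f ∘ (D ∷_)) (g ∘ (D ∷_)) n))
                   (total-+ (f ∘ (R ∷_)) (g ∘ (R ∷_)) n))
        (shuffle (T f U) (T g U) (T f D) (T g D) (T f R) (T g R))
  where
  T : Weight → Step → ℤ
  T h x = total (h ∘ (x ∷_)) n
  shuffle : ∀ a a′ b b′ c c′ → a + a′ + (b + b′) + (c + c′) ≡ a + b + c + (a′ + b′ + c′)
  shuffle = solve-∀

total-* : ∀ c f → total (λ w → c * f w) ≗ c · total f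
total-* c f zero    = refl
total-* c f (suc n) =
  trans (cong₂ _+_ (cong₂ _+_ (total-* c (f ∘ (U ∷_)) n) (total-* c (f ∘ (D ∷_)) n))
                   (total-* c (f ∘ (R ∷_)) n))
        (factor c (T U) (T D) (T R))
  where
  T : Step → ℤ
  T x = total (f ∘ (x ∷_)) n
  factor : ∀ c a b d → c * a + c * b + c * d ≡ c * (a + b + d)
  factor = solve-∀

sum-map-extensions : ∀ (f : List Step → ℕ) ws →
  sum (map f (concatMap (λ w → (U ∷ w) ∷ (D ∷ w) ∷ (R ∷ w) ∷ []) ws))
  ≡ sum (map (f ∘ (U ∷_)) ws) ℕ.+ sum (map (f ∘ (D ∷_)) ws) ℕ.+ sum (map (f ∘ (R ∷_)) ws)
sum-map-extensions f []       = refl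
sum-map-extensions f (w ∷ ws) rewrite sum-map-extensions f ws =
  shuffle (f (U ∷ w)) (f (D ∷ w)) (f (R ∷ w))
          (sum (map (f ∘ (U ∷_)) ws)) (sum (map (f ∘ (D ∷_)) ws)) (sum (map (f ∘ (R ∷_)) ws))
  where
  shuffle : ∀ a b c x y z → a ℕ.+ (b ℕ.+ (c ℕ.+ (x ℕ.+ y ℕ.+ z))) ≡ (a ℕ.+ x) ℕ.+ (b ℕ.+ y) ℕ.+ (c ℕ.+ z)
  shuffle = solveℕ

total-words : ∀ (f : List Step → ℕ) n → + sum (map f (words n)) ≡ total (λ w → + f w) n
total-words f zero    = cong +_ (ℕₚ.+-identityʳ (f []))
total-words f (suc n) = begin
  + sum (map f (words (suc n)))          ≡⟨ cong +_ (sum-map-extensions f (words n)) ⟩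
  + (σ U ℕ.+ σ D ℕ.+ σ R)                ≡⟨ trans (pos-+ (σ U ℕ.+ σ D) (σ R)) (cong (_+ + σ R) (pos-+ (σ U) (σ D))) ⟩
  + σ U + + σ D + + σ R                  ≡⟨ cong₂ _+_ (cong₂ _+_ (total-words (f ∘ (U ∷_)) n) (total-words (f ∘ (D ∷_)) n))
                                                      (total-words (f ∘ (R ∷_)) n) ⟩
  total (λ w → + f w) (suc n)            ∎
  where
  open ≡-Reasoning
  σ : Step → ℕ
  σ x = sum (map (f ∘ (x ∷_)) (words n))

infixl 7 _⊗_

-- (f ⊗ g) w = Σ over a ++ b ≡ w of f a * g b
_⊗_ : Weight → Weight → Weight
(f ⊗ g) []      = f [] * g []
(f ⊗ g) (x ∷ w) = f [] * g (x ∷ w) + ((f ∘ (x ∷_)) ⊗ g) w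

total-⊗ : ∀ f g → total (f ⊗ g) ≗ total f ⋆ total g
total-⊗ f g zero    = sym (⋆-zero (total f) (total g))
total-⊗ f g (suc n) = begin
  total (f ⊗ g) (suc n)
    ≡⟨ cong₂ _+_ (cong₂ _+_ (split U) (split D)) (split R) ⟩
  (f [] * G U + F⋆g U) + (f [] * G D + F⋆g D) + (f [] * G R + F⋆g R)
    ≡⟨ shuffle (f []) (G U) (G D) (G R) (F⋆g U) (F⋆g D) (F⋆g R) ⟩
  f [] * total g (suc n) + (F⋆g U + F⋆g D + F⋆g R)
    ≡⟨ cong (λ t → f [] * total g (suc n) + t) (sym distrib) ⟩
  f [] * total g (suc n) + ((total f ∘ suc) ⋆ total g) n
    ≡⟨ ⋆-suc (total f) (total g) n ⟨
  (total f ⋆ total g) (suc n) ∎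
  where
  open ≡-Reasoning
  G : Step → ℤ
  G x = total (g ∘ (x ∷_)) n
  F⋆g : Step → ℤ
  F⋆g x = (total (f ∘ (x ∷_)) ⋆ total g) n
  split : ∀ x → total ((f ⊗ g) ∘ (x ∷_)) n ≡ f [] * G x + F⋆g x
  split x = trans (total-+ (λ w → f [] * g (x ∷ w)) ((f ∘ (x ∷_)) ⊗ g) n)
                  (cong₂ _+_ (total-* (f []) (g ∘ (x ∷_)) n) (total-⊗ (f ∘ (x ∷_)) g n))
  distrib : ((total f ∘ suc) ⋆ total g) n ≡ F⋆g U + F⋆g D + F⋆g R
  distrib = trans (⋆-distribʳ-⊕ (total (f ∘ (U ∷_)) ⊕ total (f ∘ (D ∷_))) (total (f ∘ (R ∷_))) (total g) n)
                  (cong (_+ F⋆g R) (⋆-distribʳ-⊕ (total (f ∘ (U ∷_))) (total (f ∘ (D ∷_))) (total g) n))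
  shuffle : ∀ c a b d x y z → (c * a + x) + (c * b + y) + (c * d + z) ≡ c * (a + b + d) + (x + y + z)
  shuffle = solve-∀

⊗-∷ : ∀ f g x w → f [] ≡ + 0 → (f ⊗ g) (x ∷ w) ≡ ((f ∘ (x ∷_)) ⊗ g) w
⊗-∷ f g x w f[]≡0 rewrite f[]≡0 = +-identityˡ _

⊗-zeroˡ : ∀ g w → ((λ _ → + 0) ⊗ g) w ≡ + 0
⊗-zeroˡ g []      = refl
⊗-zeroˡ g (x ∷ w) = cong (λ t → + 0 + t) (⊗-zeroˡ g w)

ε : Weight
ε []      = + 1
ε (_ ∷ _) = + 0

⊗-identityˡ : ∀ g w → (ε ⊗ g) w ≡ g w
⊗-identityˡ g []      = *-identityˡ (g [])
⊗-identityˡ g (x ∷ w) =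
  trans (cong₂ _+_ (*-identityˡ (g (x ∷ w))) (⊗-zeroˡ g w)) (+-identityʳ (g (x ∷ w)))

total-ε : total ε ≗ one
total-ε zero    = refl
total-ε (suc n) rewrite total-zero n = refl

-- Decorated paths and first passages

decoratedFrom : ℕ → Step → List Step → Bool
decoratedFrom zero    s []      = true
decoratedFrom (suc h) s []      = false
decoratedFrom zero    s (D ∷ w) = false
decoratedFrom zero    s (R ∷ w) = false
decoratedFrom (suc h) s (D ∷ w) = decoratedFrom h D w
decoratedFrom h       R (U ∷ w) = false
decoratedFrom h       s (U ∷ w) = decoratedFrom (suc h) U w
decoratedFrom (suc h) U (R ∷ w) = false
decoratedFrom (suc h) s (R ∷ w) = decoratedFrom h R w

decoratedFrom-spec : ∀ h s w → decoratedFrom h s w ≡ dyckFrom h w ∧ noForbidden (s ∷ w)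
decoratedFrom-spec zero    U []      = refl
decoratedFrom-spec zero    D []      = refl
decoratedFrom-spec zero    R []      = refl
decoratedFrom-spec (suc h) s []      = refl
decoratedFrom-spec zero    U (U ∷ w) = decoratedFrom-spec 1 U w
decoratedFrom-spec (suc h) U (U ∷ w) = decoratedFrom-spec (suc (suc h)) U w
decoratedFrom-spec zero    D (U ∷ w) = decoratedFrom-spec 1 U w
decoratedFrom-spec (suc h) D (U ∷ w) = decoratedFrom-spec (suc (suc h)) U w
decoratedFrom-spec zero    R (U ∷ w) = sym (∧-zeroʳ (dyckFrom 1 w))
decoratedFrom-spec (suc h) R (U ∷ w) = sym (∧-zeroʳ (dyckFrom (suc (suc h)) w))
decoratedFrom-spec zero    s (D ∷ w) = refl
decoratedFrom-spec (suc h) U (D ∷ w) = decoratedFrom-spec h D w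
decoratedFrom-spec (suc h) D (D ∷ w) = decoratedFrom-spec h D w
decoratedFrom-spec (suc h) R (D ∷ w) = decoratedFrom-spec h D w
decoratedFrom-spec zero    s (R ∷ w) = refl
decoratedFrom-spec (suc h) U (R ∷ w) = sym (∧-zeroʳ (dyckFrom h w))
decoratedFrom-spec (suc h) D (R ∷ w) = decoratedFrom-spec h R w
decoratedFrom-spec (suc h) R (R ∷ w) = decoratedFrom-spec h R w

isDecorated≡decoratedFrom : ∀ w → isDecorated w ≡ decoratedFrom 0 D w
isDecorated≡decoratedFrom w = sym (decoratedFrom-spec 0 D w)

-- passage k s h w reads w from height k + 1 right after the step s; when a down-step X
-- first reaches height 0, the rest b of the word is weighed by h X b.  Words that break
-- the rules before that point, or never reach height 0, weigh 0.
passage : ℕ → Step → (Step → Weight) → Weight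
stepDown : ℕ → Step → (Step → Weight) → Weight

passage k s h []      = + 0
passage k s h (D ∷ w) = stepDown k D h w
passage k R h (U ∷ w) = + 0
passage k s h (U ∷ w) = passage (suc k) U h w
passage k U h (R ∷ w) = + 0
passage k s h (R ∷ w) = stepDown k R h w

stepDown zero    X h = h X
stepDown (suc k) X h = passage k X h

heightAfter : Step → ℕ → ℕ
heightAfter U h = suc h
heightAfter D h = pred h
heightAfter R h = pred h

BlindAboveLevel0 : (ℕ → List Step → Bool) → Set
BlindAboveLevel0 c = ∀ k x w → c (suc k) (x ∷ w) ≡ c (heightAfter x (suc k)) w

decoratedWith : (ℕ → List Step → Bool) → ℕ → Step → Weight
decoratedWith c h s w = 𝟙 (decoratedFrom h s w ∧ c h w)

decoratedWith-passage : ∀ c → BlindAboveLevel0 c →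
  ∀ k s w → decoratedWith c (suc k) s w ≡ passage k s (decoratedWith c 0) w
decoratedWith-passage c blind = go
  where
  go : ∀ k s w → decoratedWith c (suc k) s w ≡ passage k s (decoratedWith c 0) w
  go k       s []      = refl
  go k       R (U ∷ w) = refl
  go k       U (U ∷ w) rewrite blind k U w = go (suc k) U w
  go k       D (U ∷ w) rewrite blind k U w = go (suc k) U w
  go zero    s (D ∷ w) rewrite blind 0 D w = refl
  go (suc k) s (D ∷ w) rewrite blind (suc k) D w = go k D w
  go k       U (R ∷ w) = refl
  go zero    D (R ∷ w) rewrite blind 0 R w = refl
  go zero    R (R ∷ w) rewrite blind 0 R w = refl
  go (suc k) D (R ∷ w) rewrite blind (suc k) R w = go k R w
  go (suc k) R (R ∷ w) rewrite blind (suc k) R w = go k R w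

-- stop X accepts only the end of the word, right after the down-step X
stop : Step → Step → Weight
stop X U = λ _ → + 0
stop D D = ε
stop R R = ε
stop X Y = λ _ → + 0

passage-⊗ : ∀ h k s w →
  passage k s h w ≡ (passage k s (stop D) ⊗ h D) w + (passage k s (stop R) ⊗ h R) w
passage-⊗ h = go
  where
  go : ∀ k s w → passage k s h w ≡ (passage k s (stop D) ⊗ h D) w + (passage k s (stop R) ⊗ h R) w
  next : ∀ k s x w → passage k s h (x ∷ w)
       ≡ ((passage k s (stop D) ∘ (x ∷_)) ⊗ h D) w + ((passage k s (stop R) ∘ (x ∷_)) ⊗ h R) w

  go k s []      = refl
  go k s (x ∷ w) = trans (next k s x w)
    (sym (cong₂ _+_ (⊗-∷ (passage k s (stop D)) (h D) x w refl)
                    (⊗-∷ (passage k s (stop R)) (h R) x w refl)))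

  next zero    s D w = sym (trans (cong₂ _+_ (⊗-identityˡ (h D) w) (⊗-zeroˡ (h R) w)) (+-identityʳ (h D w)))
  next (suc k) s D w = go k D w
  next k       R U w = sym (cong₂ _+_ (⊗-zeroˡ (h D) w) (⊗-zeroˡ (h R) w))
  next k       U U w = go (suc k) U w
  next k       D U w = go (suc k) U w
  next k       U R w = sym (cong₂ _+_ (⊗-zeroˡ (h D) w) (⊗-zeroˡ (h R) w))
  next zero    D R w = sym (trans (cong₂ _+_ (⊗-zeroˡ (h D) w) (⊗-identityˡ (h R) w)) (+-identityˡ (h R w)))
  next zero    R R w = sym (trans (cong₂ _+_ (⊗-zeroˡ (h D) w) (⊗-identityˡ (h R) w)) (+-identityˡ (h R w)))
  next (suc k) D R w = go k R w
  next (suc k) R R w = go k R w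

letter : Step → Weight
letter X []      = + 0
letter X (Y ∷ w) = stop X Y w

-- Rules out height 0 right after U, where the first passage cannot be R alone.
data CanDescend : ℕ → Step → Set where
  from-above : ∀ {k s} → CanDescend (suc k) s
  after-D    : ∀ {k} → CanDescend k D
  after-R    : ∀ {k} → CanDescend k R

passage-stop : ∀ k s X → CanDescend k s → ∀ w →
  passage k s (stop X) w ≡ ((𝟙 ∘ decoratedFrom k s) ⊗ letter X) w
passage-stop k s X _ [] = sym (*-zeroʳ (𝟙 (decoratedFrom k s [])))
passage-stop (suc k) s X _ (x ∷ w) =
  trans (above s x w) (sym (⊗-∷ (𝟙 ∘ decoratedFrom (suc k) s) (letter X) x w refl))
  where
  above : ∀ s x w → passage (suc k) s (stop X) (x ∷ w)
        ≡ ((𝟙 ∘ decoratedFrom (suc k) s ∘ (x ∷_)) ⊗ letter X) w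
  above s D w = passage-stop k D X after-D w
  above R U w = sym (⊗-zeroˡ (letter X) w)
  above U U w = passage-stop (suc (suc k)) U X from-above w
  above D U w = passage-stop (suc (suc k)) U X from-above w
  above U R w = sym (⊗-zeroˡ (letter X) w)
  above D R w = passage-stop k R X after-R w
  above R R w = passage-stop k R X after-R w
passage-stop zero s X _ (D ∷ w) =
  sym (trans (cong₂ _+_ (*-identityˡ (stop X D w)) (⊗-zeroˡ (letter X) w)) (+-identityʳ (stop X D w)))
passage-stop zero D X _ (U ∷ w) = trans (passage-stop 1 U X from-above w) (sym (+-identityˡ _))
passage-stop zero R X _ (U ∷ w) = sym (cong (λ t → + 0 + t) (⊗-zeroˡ (letter X) w))
passage-stop zero D X _ (R ∷ w) =
  sym (trans (cong₂ _+_ (*-identityˡ (stop X R w)) (⊗-zeroˡ (letter X) w)) (+-identityʳ (stop X R w)))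
passage-stop zero R X _ (R ∷ w) =
  sym (trans (cong₂ _+_ (*-identityˡ (stop X R w)) (⊗-zeroˡ (letter X) w)) (+-identityʳ (stop X R w)))

total-letter : ∀ X → X ≢ U → total (letter X) ≗ shift one
total-letter X X≢U zero    = refl
total-letter U U≢U (suc n) = ⊥-elim (U≢U refl)
total-letter D _   (suc n) rewrite total-zero n | total-ε n = trans (+-identityʳ _) (+-identityˡ _)
total-letter R _   (suc n) rewrite total-zero n | total-ε n = +-identityˡ _

total-passage-stop : ∀ k s X → CanDescend k s → X ≢ U →
  total (passage k s (stop X)) ≗ shift (total (𝟙 ∘ decoratedFrom k s))
total-passage-stop k s X ok X≢U n = begin
  total (passage k s (stop X)) n             ≡⟨ total-cong (passage-stop k s X ok) n ⟩
  total (Q ⊗ letter X) n                     ≡⟨ total-⊗ Q (letter X) n ⟩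
  (total Q ⋆ total (letter X)) n             ≡⟨ ⋆-congʳ (total Q) (total-letter X X≢U) n ⟩
  (total Q ⋆ shift one) n                    ≡⟨ ⋆-comm (total Q) (shift one) n ⟩
  (shift one ⋆ total Q) n                    ≡⟨ shift-⋆ one (total Q) n ⟩
  shift (one ⋆ total Q) n                    ≡⟨ shift-cong (⋆-identityˡ (total Q)) n ⟩
  shift (total Q) n                          ∎
  where
  open ≡-Reasoning
  Q : Weight
  Q = 𝟙 ∘ decoratedFrom k s

total-afterR : ∀ (c : ℕ → List Step → Bool) → c 0 [] ≡ true → total (decoratedWith c 0 R) ≗ one
total-afterR c c[] zero    rewrite c[] = refl
total-afterR c c[] (suc n) rewrite total-zero n = refl

total-firstPassage : ∀ c → BlindAboveLevel0 c → c 0 [] ≡ true → ∀ k s → CanDescend k s →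
  total (decoratedWith c (suc k) s)
  ≗ (shift (total (𝟙 ∘ decoratedFrom k s)) ⋆ total (decoratedWith c 0 D)) ⊕ shift (total (𝟙 ∘ decoratedFrom k s))
total-firstPassage c blind c[] k s ok n = begin
  total (decoratedWith c (suc k) s) n
    ≡⟨ total-cong (decoratedWith-passage c blind k s) n ⟩
  total (passage k s (decoratedWith c 0)) n
    ≡⟨ total-cong (passage-⊗ (decoratedWith c 0) k s) n ⟩
  total (λ w → (first D ⊗ decoratedWith c 0 D) w + (first R ⊗ decoratedWith c 0 R) w) n
    ≡⟨ total-+ (first D ⊗ decoratedWith c 0 D) (first R ⊗ decoratedWith c 0 R) n ⟩
  total (first D ⊗ decoratedWith c 0 D) n + total (first R ⊗ decoratedWith c 0 R) n
    ≡⟨ cong₂ _+_ (total-⊗ (first D) (decoratedWith c 0 D) n) (total-⊗ (first R) (decoratedWith c 0 R) n) ⟩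
  (total (first D) ⋆ total (decoratedWith c 0 D)) n + (total (first R) ⋆ total (decoratedWith c 0 R)) n
    ≡⟨ cong₂ _+_ (⋆-congˡ (total (decoratedWith c 0 D)) (total-passage-stop k s D ok λ ()) n)
                 (⋆-cong (total-passage-stop k s R ok λ ()) (total-afterR c c[]) n) ⟩
  (F ⋆ total (decoratedWith c 0 D)) n + (F ⋆ one) n
    ≡⟨ cong (λ t → (F ⋆ total (decoratedWith c 0 D)) n + t) (⋆-identityʳ F n) ⟩
  (F ⋆ total (decoratedWith c 0 D)) n + F n ∎
  where
  open ≡-Reasoning
  first : Step → Weight
  first X = passage k s (stop X)
  F : Series
  F = shift (total (𝟙 ∘ decoratedFrom k s))

-- The generating functions

always : ℕ → List Step → Bool
always _ _ = true

noPeak : ℕ → List Step → Bool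
noPeak h w = not (peakLevel1From h w)

noPeak-blind : BlindAboveLevel0 noPeak
noPeak-blind k U w = refl
noPeak-blind k D w = refl
noPeak-blind k R w = refl

decoratedGF : Series
decoratedGF = total (𝟙 ∘ decoratedFrom 0 D)

-- a nonempty decorated path is U followed by a path from height 1
nonemptyGF : Series
nonemptyGF = shift (total (𝟙 ∘ decoratedFrom 1 U))

decoratedGF≗one⊕nonemptyGF : decoratedGF ≗ one ⊕ nonemptyGF
decoratedGF≗one⊕nonemptyGF zero    = refl
decoratedGF≗one⊕nonemptyGF (suc n) rewrite total-zero n =
  trans (+-identityʳ _) (trans (+-identityʳ _) (sym (+-identityˡ (total (𝟙 ∘ decoratedFrom 1 U) n))))

-- The first arch of U U w is U (U a) X, with U a a nonempty decorated path.
total-afterUU : ∀ n → total (𝟙 ∘ decoratedFrom 2 U) n ≡ (nonemptyGF ⋆ decoratedGF) n + nonemptyGF n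
total-afterUU n = begin
  total (𝟙 ∘ decoratedFrom 2 U) n
    ≡⟨ total-cong (λ w → cong 𝟙 (∧-identityʳ _)) n ⟨
  total (decoratedWith always 2 U) n
    ≡⟨ total-firstPassage always (λ _ _ _ → refl) refl 1 U from-above n ⟩
  (nonemptyGF ⋆ total (decoratedWith always 0 D)) n + nonemptyGF n
    ≡⟨ cong (_+ nonemptyGF n) (⋆-congʳ nonemptyGF (total-cong (λ w → cong 𝟙 (∧-identityʳ _))) n) ⟩
  (nonemptyGF ⋆ decoratedGF) n + nonemptyGF n ∎
  where open ≡-Reasoning

nonemptyGF-equation : nonemptyGF ≗ x· (one ⊕ + 3 · nonemptyGF ⊕ nonemptyGF ⋆ nonemptyGF)
nonemptyGF-equation zero = refl
nonemptyGF-equation (suc zero) = refl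
nonemptyGF-equation (suc (suc n)) rewrite total-zero n = begin
  total (𝟙 ∘ decoratedFrom 2 U) n + decoratedGF n + + 0
    ≡⟨ +-identityʳ _ ⟩
  total (𝟙 ∘ decoratedFrom 2 U) n + decoratedGF n
    ≡⟨ cong₂ _+_ (total-afterUU n) (decoratedGF≗one⊕nonemptyGF n) ⟩
  (C ⋆ decoratedGF) n + C n + (one n + C n)
    ≡⟨ cong (λ t → t + C n + (one n + C n)) C⋆decoratedGF ⟩
  C n + (C ⋆ C) n + C n + (one n + C n)
    ≡⟨ collect (C n) ((C ⋆ C) n) (one n) ⟩
  one n + + 3 * C n + (C ⋆ C) n ∎
  where
  open ≡-Reasoning
  C : Series
  C = nonemptyGF
  C⋆decoratedGF : (C ⋆ decoratedGF) n ≡ C n + (C ⋆ C) n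
  C⋆decoratedGF = begin
    (C ⋆ decoratedGF) n          ≡⟨ ⋆-comm C decoratedGF n ⟩
    (decoratedGF ⋆ C) n          ≡⟨ ⋆-congˡ C decoratedGF≗one⊕nonemptyGF n ⟩
    ((one ⊕ C) ⋆ C) n            ≡⟨ ⋆-distribʳ-⊕ one C C n ⟩
    (one ⋆ C) n + (C ⋆ C) n      ≡⟨ cong (_+ (C ⋆ C) n) (⋆-identityˡ C n) ⟩
    C n + (C ⋆ C) n              ∎
  collect : ∀ c q e → c + q + c + (e + c) ≡ e + + 3 * c + q
  collect = solve-∀

P≗total-noPeak : P ≗ total (decoratedWith noPeak 0 D)
P≗total-noPeak n = trans (total-words (λ w → if good w then 1 else 0) n)
  (total-cong (λ w → cong (λ b → 𝟙 (b ∧ noPeak 0 w)) (isDecorated≡decoratedFrom w)) n)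

total-noPeak-suc-suc : ∀ n → total (decoratedWith noPeak 0 D) (suc (suc n)) ≡ total (decoratedWith noPeak 2 U) n
total-noPeak-suc-suc n = begin
  total (decoratedWith noPeak 0 D) (suc (suc n))
    ≡⟨ cong₂ _+_ (cong₂ _+_ (cong₂ _+_ (cong (λ t → total (decoratedWith noPeak 2 U) n + t) peakAtStart)
                                        (total-zero n))
                            (total-zero (suc n)))
                 (total-zero (suc n)) ⟩
  total (decoratedWith noPeak 2 U) n + + 0 + + 0 + + 0 + + 0
    ≡⟨ dropZeros (total (decoratedWith noPeak 2 U) n) ⟩
  total (decoratedWith noPeak 2 U) n ∎
  where
  open ≡-Reasoning
  peakAtStart : total (λ w → 𝟙 (decoratedFrom 0 D w ∧ false)) n ≡ + 0
  peakAtStart = trans (total-cong (λ w → cong 𝟙 (∧-zeroʳ (decoratedFrom 0 D w))) n) (total-zero n)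
  dropZeros : ∀ a → a + + 0 + + 0 + + 0 + + 0 ≡ a
  dropZeros = solve-∀

P-equation : P ≗ one ⊕ x· (nonemptyGF ⋆ P ⊕ nonemptyGF)
P-equation zero          = refl
P-equation (suc zero)    = refl
P-equation (suc (suc n)) = begin
  P (suc (suc n))
    ≡⟨ trans (P≗total-noPeak (suc (suc n))) (total-noPeak-suc-suc n) ⟩
  total (decoratedWith noPeak 2 U) n
    ≡⟨ total-firstPassage noPeak noPeak-blind refl 1 U from-above n ⟩
  (nonemptyGF ⋆ total (decoratedWith noPeak 0 D)) n + nonemptyGF n
    ≡⟨ cong (_+ nonemptyGF n) (⋆-congʳ nonemptyGF P≗total-noPeak n) ⟨
  (nonemptyGF ⋆ P) n + nonemptyGF n
    ≡⟨ +-identityˡ _ ⟨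
  + 0 + ((nonemptyGF ⋆ P) n + nonemptyGF n) ∎
  where open ≡-Reasoning

squareRoot : Series
squareRoot = one ⊕ -[1+ 2 ] · x· one ⊕ -[1+ 1 ] · x· nonemptyGF

squareRoot-⋆ : ∀ f → squareRoot ⋆ f ≗ f ⊕ -[1+ 2 ] · x· f ⊕ -[1+ 1 ] · x· (nonemptyGF ⋆ f)
squareRoot-⋆ f n = begin
  (squareRoot ⋆ f) n
    ≡⟨ ⋆-distribʳ-⊕ (one ⊕ -[1+ 2 ] · x· one) (-[1+ 1 ] · x· nonemptyGF) f n ⟩
  ((one ⊕ -[1+ 2 ] · x· one) ⋆ f) n + ((-[1+ 1 ] · x· nonemptyGF) ⋆ f) n
    ≡⟨ cong₂ _+_ (⋆-distribʳ-⊕ one (-[1+ 2 ] · x· one) f n) (·x·-⋆ -[1+ 1 ] nonemptyGF f n) ⟩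
  (one ⋆ f) n + ((-[1+ 2 ] · x· one) ⋆ f) n + -[1+ 1 ] * (x· (nonemptyGF ⋆ f)) n
    ≡⟨ cong (λ t → t + -[1+ 1 ] * (x· (nonemptyGF ⋆ f)) n)
            (cong₂ _+_ (⋆-identityˡ f n)
                       (trans (·x·-⋆ -[1+ 2 ] one f n) (cong (-[1+ 2 ] *_) (x·-cong (⋆-identityˡ f) n)))) ⟩
  f n + -[1+ 2 ] * (x· f) n + -[1+ 1 ] * (x· (nonemptyGF ⋆ f)) n ∎
  where open ≡-Reasoning

defect : Series
defect = + 3 · P ⊕ x· P ⊕ -[1+ 2 ] · one ⊕ x· one ⊕ -[1+ 1 ] · nonemptyGF

defect⋆nonemptyGF : ∀ n → (defect ⋆ nonemptyGF) n
  ≡ + 3 * (nonemptyGF ⋆ P) n + (x· (nonemptyGF ⋆ P)) n + -[1+ 2 ] * nonemptyGF n + (x· nonemptyGF) n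
    + -[1+ 1 ] * (nonemptyGF ⋆ nonemptyGF) n
defect⋆nonemptyGF n = begin
  (defect ⋆ C) n
    ≡⟨ trans (⋆-distribʳ-⊕ (t₁ ⊕ t₂ ⊕ t₃ ⊕ t₄) t₅ C n) (cong (_+ (t₅ ⋆ C) n)
      (trans (⋆-distribʳ-⊕ (t₁ ⊕ t₂ ⊕ t₃) t₄ C n) (cong (_+ (t₄ ⋆ C) n)
      (trans (⋆-distribʳ-⊕ (t₁ ⊕ t₂) t₃ C n) (cong (_+ (t₃ ⋆ C) n)
             (⋆-distribʳ-⊕ t₁ t₂ C n)))))) ⟩
  (t₁ ⋆ C) n + (t₂ ⋆ C) n + (t₃ ⋆ C) n + (t₄ ⋆ C) n + (t₅ ⋆ C) n
    ≡⟨ cong₂ _+_ (cong₂ _+_ (cong₂ _+_ (cong₂ _+_ (·-⋆-assoc (+ 3) P C n) (x·-⋆ P C n))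
                                        (·-⋆-assoc -[1+ 2 ] one C n)) (x·-⋆ one C n))
                 (·-⋆-assoc -[1+ 1 ] C C n) ⟩
  + 3 * (P ⋆ C) n + (x· (P ⋆ C)) n + -[1+ 2 ] * (one ⋆ C) n + (x· (one ⋆ C)) n + -[1+ 1 ] * (C ⋆ C) n
    ≡⟨ cong₂ _+_ (cong₂ _+_ (cong₂ _+_ (cong₂ _+_ (cong (+ 3 *_) (⋆-comm P C n)) (x·-cong (⋆-comm P C) n))
                                        (cong (-[1+ 2 ] *_) (⋆-identityˡ C n))) (x·-cong (⋆-identityˡ C) n))
                 refl ⟩
  + 3 * (C ⋆ P) n + (x· (C ⋆ P)) n + -[1+ 2 ] * C n + (x· C) n + -[1+ 1 ] * (C ⋆ C) n ∎
  where
  open ≡-Reasoning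
  C t₁ t₂ t₃ t₄ t₅ : Series
  C  = nonemptyGF
  t₁ = + 3 · P
  t₂ = x· P
  t₃ = -[1+ 2 ] · one
  t₄ = x· one
  t₅ = -[1+ 1 ] · C

defect-equation : defect ≗ x· (defect ⋆ nonemptyGF)
defect-equation zero                = refl
defect-equation (suc zero)          = refl
defect-equation (suc (suc zero))    = refl
defect-equation (suc (suc (suc zero))) = refl
defect-equation (suc (suc (suc (suc m)))) =
  trans (substitute (P-equation (4 ℕ.+ m)) (P-equation (2 ℕ.+ m)) (nonemptyGF-equation (4 ℕ.+ m)))
        (sym (defect⋆nonemptyGF (2 ℕ.+ m)))
  where
  C : Series
  C = nonemptyGF
  substitute : ∀ {p₄ p₂ c₄} → p₄ ≡ + 0 + ((C ⋆ P) (2 ℕ.+ m) + C (2 ℕ.+ m)) → p₂ ≡ + 0 + ((C ⋆ P) m + C m)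
             → c₄ ≡ + 0 + + 3 * C (2 ℕ.+ m) + (C ⋆ C) (2 ℕ.+ m)
             → + 3 * p₄ + p₂ + -[1+ 2 ] * + 0 + + 0 + -[1+ 1 ] * c₄
             ≡ + 3 * (C ⋆ P) (2 ℕ.+ m) + (C ⋆ P) m + -[1+ 2 ] * C (2 ℕ.+ m) + C m + -[1+ 1 ] * (C ⋆ C) (2 ℕ.+ m)
  substitute refl refl refl = identity ((C ⋆ P) (2 ℕ.+ m)) (C (2 ℕ.+ m)) ((C ⋆ P) m) (C m) ((C ⋆ C) (2 ℕ.+ m))
    where
    identity : ∀ a b c d e → + 3 * (+ 0 + (a + b)) + (+ 0 + (c + d)) + -[1+ 2 ] * + 0 + + 0 + -[1+ 1 ] * (+ 0 + + 3 * b + e)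
                           ≡ + 3 * a + c + -[1+ 2 ] * b + d + -[1+ 1 ] * e
    identity = solve-∀

defect≗0 : ∀ n → defect n ≡ + 0
defect≗0 = x·⋆-fixedPoint-zero defect nonemptyGF defect-equation

squareRoot⋆squareRoot : squareRoot ⋆ squareRoot ≗ poly (+ 1 ∷ + 0 ∷ -[1+ 5 ] ∷ + 0 ∷ + 5 ∷ [])
squareRoot⋆squareRoot 0 = refl
squareRoot⋆squareRoot 1 = refl
squareRoot⋆squareRoot 2 = refl
squareRoot⋆squareRoot 3 = refl
squareRoot⋆squareRoot 4 = refl
squareRoot⋆squareRoot (suc (suc (suc (suc (suc m))))) = begin
  (squareRoot ⋆ squareRoot) (5 ℕ.+ m)
    ≡⟨ squareRoot-⋆ squareRoot (5 ℕ.+ m) ⟩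
  squareRoot (5 ℕ.+ m) + -[1+ 2 ] * squareRoot (3 ℕ.+ m) + -[1+ 1 ] * (C ⋆ squareRoot) (3 ℕ.+ m)
    ≡⟨ cong (λ t → squareRoot (5 ℕ.+ m) + -[1+ 2 ] * squareRoot (3 ℕ.+ m) + -[1+ 1 ] * t)
            (trans (⋆-comm C squareRoot (3 ℕ.+ m)) (squareRoot-⋆ C (3 ℕ.+ m))) ⟩
  squareRoot (5 ℕ.+ m) + -[1+ 2 ] * squareRoot (3 ℕ.+ m)
    + -[1+ 1 ] * (C (3 ℕ.+ m) + -[1+ 2 ] * C (1 ℕ.+ m) + -[1+ 1 ] * (C ⋆ C) (1 ℕ.+ m))
    ≡⟨ substitute (nonemptyGF-equation (3 ℕ.+ m)) ⟩
  + 0 ∎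
  where
  open ≡-Reasoning
  C : Series
  C = nonemptyGF
  substitute : ∀ {c₃} → c₃ ≡ + 0 + + 3 * C (1 ℕ.+ m) + (C ⋆ C) (1 ℕ.+ m)
    → + 0 + -[1+ 2 ] * + 0 + -[1+ 1 ] * c₃ + -[1+ 2 ] * (+ 0 + -[1+ 2 ] * + 0 + -[1+ 1 ] * C (1 ℕ.+ m))
      + -[1+ 1 ] * (c₃ + -[1+ 2 ] * C (1 ℕ.+ m) + -[1+ 1 ] * (C ⋆ C) (1 ℕ.+ m))
    ≡ + 0
  substitute refl = identity (C (1 ℕ.+ m)) ((C ⋆ C) (1 ℕ.+ m))
    where
    identity : ∀ c q → + 0 + -[1+ 2 ] * + 0 + -[1+ 1 ] * (+ 0 + + 3 * c + q)
                       + -[1+ 2 ] * (+ 0 + -[1+ 2 ] * + 0 + -[1+ 1 ] * c)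
                       + -[1+ 1 ] * ((+ 0 + + 3 * c + q) + -[1+ 2 ] * c + -[1+ 1 ] * q)
                     ≡ + 0
    identity = solve-∀

x[3+x]≗x·[3+x] : poly (+ 0 ∷ + 0 ∷ + 3 ∷ + 0 ∷ + 1 ∷ []) ≗ x· (+ 3 · one ⊕ x· one)
x[3+x]≗x·[3+x] 0 = refl
x[3+x]≗x·[3+x] 1 = refl
x[3+x]≗x·[3+x] 2 = refl
x[3+x]≗x·[3+x] 3 = refl
x[3+x]≗x·[3+x] 4 = refl
x[3+x]≗x·[3+x] (suc (suc (suc (suc (suc m))))) = refl

x[3+x]⋆P : poly (+ 0 ∷ + 0 ∷ + 3 ∷ + 0 ∷ + 1 ∷ []) ⋆ P ≗ (poly (+ 1 ∷ + 0 ∷ + 0 ∷ + 0 ∷ -[1+ 0 ] ∷ []) ⊝ squareRoot)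
x[3+x]⋆P 0 = refl
x[3+x]⋆P 1 = refl
x[3+x]⋆P 2 = refl
x[3+x]⋆P 3 = refl
x[3+x]⋆P 4 = refl
x[3+x]⋆P (suc (suc (suc (suc (suc m))))) = begin
  (poly (+ 0 ∷ + 0 ∷ + 3 ∷ + 0 ∷ + 1 ∷ []) ⋆ P) (5 ℕ.+ m)
    ≡⟨ trans (⋆-congˡ P x[3+x]≗x·[3+x] (5 ℕ.+ m)) (x·-⋆ (+ 3 · one ⊕ x· one) P (5 ℕ.+ m)) ⟩
  ((+ 3 · one ⊕ x· one) ⋆ P) (3 ℕ.+ m)
    ≡⟨ ⋆-distribʳ-⊕ (+ 3 · one) (x· one) P (3 ℕ.+ m) ⟩
  ((+ 3 · one) ⋆ P) (3 ℕ.+ m) + ((x· one) ⋆ P) (3 ℕ.+ m)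
    ≡⟨ cong₂ _+_ (trans (·-⋆-assoc (+ 3) one P (3 ℕ.+ m)) (cong (+ 3 *_) (⋆-identityˡ P (3 ℕ.+ m))))
                 (trans (x·-⋆ one P (3 ℕ.+ m)) (⋆-identityˡ P (1 ℕ.+ m))) ⟩
  + 3 * P (3 ℕ.+ m) + P (1 ℕ.+ m)
    ≡⟨ solve (P (3 ℕ.+ m)) (P (1 ℕ.+ m)) (C (3 ℕ.+ m)) (defect≗0 (3 ℕ.+ m)) ⟩
  + 0 - squareRoot (5 ℕ.+ m) ∎
  where
  open ≡-Reasoning
  C : Series
  C = nonemptyGF
  solve : ∀ p₃ p₁ c₃ → + 3 * p₃ + p₁ + -[1+ 2 ] * + 0 + + 0 + -[1+ 1 ] * c₃ ≡ + 0
        → + 3 * p₃ + p₁ ≡ + 0 - (+ 0 + -[1+ 2 ] * + 0 + -[1+ 1 ] * c₃)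
  solve p₃ p₁ c₃ d≡0 = trans (identity₁ p₃ p₁ c₃) (trans (cong (_+ + 2 * c₃) d≡0) (identity₂ c₃))
    where
    identity₁ : ∀ p₃ p₁ c₃ → + 3 * p₃ + p₁ ≡ + 3 * p₃ + p₁ + -[1+ 2 ] * + 0 + + 0 + -[1+ 1 ] * c₃ + + 2 * c₃
    identity₁ = solve-∀
    identity₂ : ∀ c₃ → + 0 + + 2 * c₃ ≡ + 0 - (+ 0 + -[1+ 2 ] * + 0 + -[1+ 1 ] * c₃)
    identity₂ = solve-∀

mainTheorem1 : Σ Series (λ S →
    (S 0 ≡ + 1)
    × ((S ⋆ S) ≗ poly (+ 1 ∷ + 0 ∷ -[1+ 5 ] ∷ + 0 ∷ + 5 ∷ []))
    × ((poly (+ 0 ∷ + 0 ∷ + 3 ∷ + 0 ∷ + 1 ∷ []) ⋆ P)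
    ≗ (poly (+ 1 ∷ + 0 ∷ + 0 ∷ + 0 ∷ -[1+ 0 ] ∷ []) ⊝ S)))
mainTheorem1 = squareRoot , refl , squareRoot⋆squareRoot , x[3+x]⋆P
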